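{- Let $n$ and $k$ be positive integers and let $(X,Y)$ be a partition of $\{1,2,\ldots,n\}$ into two sets. Call a pair $(a,b)$ bad if $a<b$, $a\in Y$ and $b\in X$. Assume that for every integer $t$ there are at most $k$ bad pairs $(a,b)$ with $a\le t<b$. Then the total number of bad pairs is at most $k(1+\ln k)$. -}

module Defs where

open import Data.Nat using (ℕ; zero; suc; _+_; _*_; _^_; _≤ᵇ_; _<ᵇ_)
open import Data.Bool using (Bool; true; false; _∧_; not; if_then_else_)
open import Data.Fin using (Fin; toℕ)
open import Data.List using (List; length; filterᵇ; allFin; cartesianProduct)
open import Data.Product using (_×_; _,_)

-- A colouring  inY : Fin n → Bool  encodes the partition (X , Y) of
-- {1,…,n}: the element  toℕ i + 1  lies in Y iff  inY i ≡ true,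
-- otherwise it lies in X.

allPairs : (n : ℕ) → List (Fin n × Fin n)
allPairs n = cartesianProduct (allFin n) (allFin n)

isBad : {n : ℕ} → (Fin n → Bool) → Fin n × Fin n → Bool
isBad inY (a , b) = (toℕ a <ᵇ toℕ b) ∧ (inY a ∧ not (inY b))

badCount : (n : ℕ) → (Fin n → Bool) → ℕ
badCount n inY = length (filterᵇ (isBad inY) (allPairs n))

-- number of bad pairs (a , b) with a ≤ t < b   (in 0-based indices;
-- threshold t here corresponds to threshold t+1 on {1,…,n})
crossCount : (n : ℕ) → (Fin n → Bool) → ℕ → ℕ
crossCount n inY t =
  length (filterᵇ (λ p → isBad inY p ∧ crossing p) (allPairs n))
  where
  crossing : Fin n × Fin n → Bool
  crossing (a , b) = (toℕ a ≤ᵇ t) ∧ (t <ᵇ toℕ b)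

fact : ℕ → ℕ
fact zero    = 1
fact (suc m) = suc m * fact m

-- expScaled m J = J! * Σ_{j=0}^{J} m^j / j!   (a natural number),
-- i.e. J! times the J-th partial sum of the exponential series at m.
expScaled : ℕ → ℕ → ℕ
expScaled m zero    = 1
expScaled m (suc J) = suc J * expScaled m J + m ^ suc J

-- ExpLe m K  ⇔  e^m ≤ K   (as real numbers), expressed via the partial
-- sums of the exponential series (which increase to e^m).
ExpLe : ℕ → ℕ → Set
ExpLe m K = ∀ (J : ℕ) → expScaled m J ≤ K * fact J
  where open import Data.Nat using (_≤_)

-- LeKLogK N k  ⇔  N ≤ k (1 + ln k)   for k ≥ 1.
-- Indeed N ≤ k + k ln k ⇔ N - k ≤ k ln k ⇔ e^(N - k) ≤ k^k
-- (trivially true when N ≤ k, matching truncated subtraction).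
LeKLogK : ℕ → ℕ → Set
LeKLogK N k = ExpLe (N ∸ k) (k ^ k)
  where open import Data.Nat using (_∸_)

{-# OPTIONS --safe #-}
module Submission where

-- Let y₁ < y₂ < … be the elements of Y and zᵢ the number of elements of X above yᵢ, so
-- that there are z₁ + z₂ + … bad pairs.  At the threshold yᵢ at least i · zᵢ bad pairs
-- cross, hence i · zᵢ ≤ k.  As e^(1/i) ≤ i/(i-1), for i ≥ 2 this gives
-- e^zᵢ ≤ (i/(i-1))^(i zᵢ) ≤ (i/(i-1))^k, and the product telescopes (zᵢ = 0 for i > k):
-- e^(z₂ + z₃ + …) ≤ k^k, while z₁ ≤ k.  Without real numbers, e^x ≤ P/Q is stated for all
-- partial sums of the exponential series; these satisfy e^(x+y) ≤ e^x e^y because the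
-- Cauchy product of the series at x and at y is the series at x + y.

open import Defs
open import Data.Nat using (ℕ; zero; suc)
open import Function using (_∘_; id)
open import Relation.Binary.PropositionalEquality

module ExpBounds where
  import Data.Nat as ℕ
  import Data.Nat.Properties as ℕₚ
  open import Data.Rational
    using (ℚ; 0ℚ; 1ℚ; _+_; _*_; _-_; _≤_; _<_; 1/_; NonZero; positive; nonNegative)
  open import Data.Rational.Properties
  open import Data.Rational.Solver using (module +-*-Solver)
  open import Relation.Nullary using (yes; no; contradiction)
  open +-*-Solver

  fromℕ : ℕ → ℚ
  fromℕ zero    = 0ℚ
  fromℕ (suc n) = 1ℚ + fromℕ n

  fromℕ-+ : ∀ m n → fromℕ (m ℕ.+ n) ≡ fromℕ m + fromℕ n
  fromℕ-+ zero    n = sym (+-identityˡ (fromℕ n))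
  fromℕ-+ (suc m) n = trans (cong (1ℚ +_) (fromℕ-+ m n)) (sym (+-assoc 1ℚ (fromℕ m) (fromℕ n)))

  fromℕ-* : ∀ m n → fromℕ (m ℕ.* n) ≡ fromℕ m * fromℕ n
  fromℕ-* zero    n = sym (*-zeroˡ (fromℕ n))
  fromℕ-* (suc m) n = begin
    fromℕ (n ℕ.+ m ℕ.* n)        ≡⟨ fromℕ-+ n (m ℕ.* n) ⟩
    fromℕ n + fromℕ (m ℕ.* n)    ≡⟨ cong (fromℕ n +_) (fromℕ-* m n) ⟩
    fromℕ n + fromℕ m * fromℕ n  ≡⟨ solve 2 (λ a b → a :+ b :* a := (con 1ℚ :+ b) :* a) refl (fromℕ n) (fromℕ m) ⟩
    (1ℚ + fromℕ m) * fromℕ n     ∎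
    where open ≡-Reasoning

  0≤1 : 0ℚ ≤ 1ℚ
  0≤1 = <⇒≤ (positive⁻¹ 1ℚ)

  fromℕ-nonNeg : ∀ n → 0ℚ ≤ fromℕ n
  fromℕ-nonNeg zero    = ≤-refl
  fromℕ-nonNeg (suc n) = +-mono-≤ 0≤1 (fromℕ-nonNeg n)

  fromℕ-mono-≤ : ∀ {m n} → m ℕ.≤ n → fromℕ m ≤ fromℕ n
  fromℕ-mono-≤ {n = n} ℕ.z≤n   = fromℕ-nonNeg n
  fromℕ-mono-≤         (ℕ.s≤s p) = +-monoʳ-≤ 1ℚ (fromℕ-mono-≤ p)

  fromℕ-mono-< : ∀ {m n} → m ℕ.< n → fromℕ m < fromℕ n
  fromℕ-mono-< {m} p = <-≤-trans m<1+m (fromℕ-mono-≤ p)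
    where
    m<1+m : fromℕ m < 1ℚ + fromℕ m
    m<1+m = subst (_< 1ℚ + fromℕ m) (+-identityˡ (fromℕ m)) (+-monoˡ-< (fromℕ m) (positive⁻¹ 1ℚ))

  fromℕ-cancel-≤ : ∀ {m n} → fromℕ m ≤ fromℕ n → m ℕ.≤ n
  fromℕ-cancel-≤ {m} {n} p with m ℕ.≤? n
  ... | yes m≤n = m≤n
  ... | no  m≰n = contradiction (<-≤-trans (fromℕ-mono-< (ℕₚ.≰⇒> m≰n)) p) (<-irrefl refl)

  fromℕ-pos : ∀ n → 0ℚ < fromℕ (suc n)
  fromℕ-pos n = +-mono-<-≤ (positive⁻¹ 1ℚ) (fromℕ-nonNeg n)

  nonNeg-* : ∀ {a b} → 0ℚ ≤ a → 0ℚ ≤ b → 0ℚ ≤ a * b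
  nonNeg-* {a} {b} a≥0 b≥0 =
    nonNegative⁻¹ (a * b) {{nonNeg*nonNeg⇒nonNeg a {{nonNegative a≥0}} b {{nonNegative b≥0}}}}

  *-monoˡ-≤-≥0 : ∀ {r p q} → 0ℚ ≤ r → p ≤ q → r * p ≤ r * q
  *-monoˡ-≤-≥0 {r} r≥0 = *-monoˡ-≤-nonNeg r {{nonNegative r≥0}}

  *-monoʳ-≤-≥0 : ∀ {r p q} → 0ℚ ≤ r → p ≤ q → p * r ≤ q * r
  *-monoʳ-≤-≥0 {r} r≥0 = *-monoʳ-≤-nonNeg r {{nonNegative r≥0}}

  *-mono-≤-≥0 : ∀ {a b c d} → 0ℚ ≤ a → 0ℚ ≤ c → a ≤ b → c ≤ d → a * c ≤ b * d
  *-mono-≤-≥0 a≥0 c≥0 a≤b c≤d = ≤-trans (*-monoʳ-≤-≥0 c≥0 a≤b) (*-monoˡ-≤-≥0 (≤-trans a≥0 a≤b) c≤d)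

  fromℕ-suc-nonZero : ∀ i → NonZero (fromℕ (suc i))
  fromℕ-suc-nonZero i = pos⇒nonZero (fromℕ (suc i)) {{positive (fromℕ-pos i)}}

  1/[1+_] : ℕ → ℚ
  1/[1+ i ] = (1/ fromℕ (suc i)) {{fromℕ-suc-nonZero i}}

  1/[1+]-inverseʳ : ∀ i → fromℕ (suc i) * 1/[1+ i ] ≡ 1ℚ
  1/[1+]-inverseʳ i = *-inverseʳ (fromℕ (suc i)) {{fromℕ-suc-nonZero i}}

  1/[1+]-nonNeg : ∀ i → 0ℚ ≤ 1/[1+ i ]
  1/[1+]-nonNeg i = <⇒≤ (positive⁻¹ 1/[1+ i ] {{1/pos⇒pos (fromℕ (suc i)) {{positive (fromℕ-pos i)}}}})

  1/[1+]≤1 : ∀ i → 1/[1+ i ] ≤ 1ℚ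
  1/[1+]≤1 i = subst₂ _≤_ (*-identityʳ 1/[1+ i ]) (trans (*-comm 1/[1+ i ] _) (1/[1+]-inverseʳ i))
    (*-monoˡ-≤-≥0 (1/[1+]-nonNeg i) 1≤1+i)
    where
    1≤1+i : 1ℚ ≤ fromℕ (suc i)
    1≤1+i = subst (_≤ fromℕ (suc i)) (+-identityʳ 1ℚ) (+-monoʳ-≤ 1ℚ (fromℕ-nonNeg i))

  expTerm : ℚ → ℕ → ℚ
  expTerm x zero    = 1ℚ
  expTerm x (suc i) = x * expTerm x i * 1/[1+ i ]

  expTerm-suc : ∀ x i → fromℕ (suc i) * expTerm x (suc i) ≡ x * expTerm x i
  expTerm-suc x i = begin
    fromℕ (suc i) * (x * expTerm x i * 1/[1+ i ])
      ≡⟨ solve 4 (λ a b c d → a :* (b :* c :* d) := b :* c :* (a :* d)) refl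
           (fromℕ (suc i)) x (expTerm x i) 1/[1+ i ] ⟩
    x * expTerm x i * (fromℕ (suc i) * 1/[1+ i ])
      ≡⟨ cong (x * expTerm x i *_) (1/[1+]-inverseʳ i) ⟩
    x * expTerm x i * 1ℚ
      ≡⟨ *-identityʳ _ ⟩
    x * expTerm x i ∎
    where open ≡-Reasoning

  expTerm-nonNeg : ∀ {x} → 0ℚ ≤ x → ∀ i → 0ℚ ≤ expTerm x i
  expTerm-nonNeg x≥0 zero    = 0≤1
  expTerm-nonNeg x≥0 (suc i) = nonNeg-* (nonNeg-* x≥0 (expTerm-nonNeg x≥0 i)) (1/[1+]-nonNeg i)

  expTerm-mono-≤ : ∀ {x y} → 0ℚ ≤ x → x ≤ y → ∀ i → expTerm x i ≤ expTerm y i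
  expTerm-mono-≤ x≥0 x≤y zero    = ≤-refl
  expTerm-mono-≤ x≥0 x≤y (suc i) =
    *-mono-≤-≥0 (nonNeg-* x≥0 (expTerm-nonNeg x≥0 i)) (1/[1+]-nonNeg i)
      (*-mono-≤-≥0 x≥0 (expTerm-nonNeg x≥0 i) x≤y (expTerm-mono-≤ x≥0 x≤y i)) ≤-refl

  sumTo : ℕ → (ℕ → ℚ) → ℚ
  sumTo zero    f = f 0
  sumTo (suc J) f = sumTo J f + f (suc J)

  sumTo-cong : ∀ J {f g} → (∀ i → f i ≡ g i) → sumTo J f ≡ sumTo J g
  sumTo-cong zero    f≗g = f≗g 0
  sumTo-cong (suc J) f≗g = cong₂ _+_ (sumTo-cong J f≗g) (f≗g (suc J))

  sumTo-distrib-+ : ∀ J f g → sumTo J (λ i → f i + g i) ≡ sumTo J f + sumTo J g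
  sumTo-distrib-+ zero    f g = refl
  sumTo-distrib-+ (suc J) f g =
    trans (cong (_+ (f (suc J) + g (suc J))) (sumTo-distrib-+ J f g))
      (solve 4 (λ a b c d → (a :+ b) :+ (c :+ d) := (a :+ c) :+ (b :+ d)) refl
        (sumTo J f) (sumTo J g) (f (suc J)) (g (suc J)))

  sumTo-distribʳ-* : ∀ J f c → sumTo J (λ i → f i * c) ≡ sumTo J f * c
  sumTo-distribʳ-* zero    f c = refl
  sumTo-distribʳ-* (suc J) f c =
    trans (cong (_+ f (suc J) * c) (sumTo-distribʳ-* J f c)) (sym (*-distribʳ-+ c (sumTo J f) (f (suc J))))

  sumTo-distribˡ-* : ∀ J c f → sumTo J (λ i → c * f i) ≡ c * sumTo J f
  sumTo-distribˡ-* J c f =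
    trans (sumTo-cong J (λ i → *-comm c (f i))) (trans (sumTo-distribʳ-* J f c) (*-comm (sumTo J f) c))

  sumTo-unfoldˡ : ∀ J f → sumTo (suc J) f ≡ f 0 + sumTo J (λ i → f (suc i))
  sumTo-unfoldˡ zero    f = refl
  sumTo-unfoldˡ (suc J) f = trans (cong (_+ f (suc (suc J))) (sumTo-unfoldˡ J f)) (+-assoc (f 0) _ _)

  sumTo-mono-≤ : ∀ J {f g} → (∀ i → f i ≤ g i) → sumTo J f ≤ sumTo J g
  sumTo-mono-≤ zero    f≤g = f≤g 0
  sumTo-mono-≤ (suc J) f≤g = +-mono-≤ (sumTo-mono-≤ J f≤g) (f≤g (suc J))

  sumTo-nonNeg : ∀ J {f} → (∀ i → 0ℚ ≤ f i) → 0ℚ ≤ sumTo J f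
  sumTo-nonNeg zero    f≥0 = f≥0 0
  sumTo-nonNeg (suc J) f≥0 = +-mono-≤ (sumTo-nonNeg J f≥0) (f≥0 (suc J))

  sumTo-≤-suc : ∀ J {f} → (∀ i → 0ℚ ≤ f i) → sumTo J f ≤ sumTo (suc J) f
  sumTo-≤-suc J {f} f≥0 =
    subst (_≤ sumTo (suc J) f) (+-identityʳ (sumTo J f)) (+-monoʳ-≤ (sumTo J f) (f≥0 (suc J)))

  sumAntidiagonal : ℕ → (ℕ → ℕ → ℚ) → ℚ
  sumAntidiagonal zero    g = g 0 0
  sumAntidiagonal (suc n) g = g 0 (suc n) + sumAntidiagonal n (λ i l → g (suc i) l)

  sumAntidiagonal-cong : ∀ n {g h} → (∀ i l → g i l ≡ h i l) → sumAntidiagonal n g ≡ sumAntidiagonal n h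
  sumAntidiagonal-cong zero    g≗h = g≗h 0 0
  sumAntidiagonal-cong (suc n) g≗h =
    cong₂ _+_ (g≗h 0 (suc n)) (sumAntidiagonal-cong n (λ i l → g≗h (suc i) l))

  sumAntidiagonal-unfoldʳ : ∀ n g →
    sumAntidiagonal (suc n) g ≡ sumAntidiagonal n (λ i l → g i (suc l)) + g (suc n) 0
  sumAntidiagonal-unfoldʳ zero    g = refl
  sumAntidiagonal-unfoldʳ (suc n) g =
    trans (cong (g 0 (suc (suc n)) +_) (sumAntidiagonal-unfoldʳ n (λ i l → g (suc i) l)))
      (sym (+-assoc (g 0 (suc (suc n))) _ _))

  sumAntidiagonal-distrib-+ : ∀ n g h →
    sumAntidiagonal n (λ i l → g i l + h i l) ≡ sumAntidiagonal n g + sumAntidiagonal n h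
  sumAntidiagonal-distrib-+ zero    g h = refl
  sumAntidiagonal-distrib-+ (suc n) g h =
    trans (cong (g 0 (suc n) + h 0 (suc n) +_) (sumAntidiagonal-distrib-+ n _ _))
      (solve 4 (λ a b c d → (a :+ b) :+ (c :+ d) := (a :+ c) :+ (b :+ d)) refl
        (g 0 (suc n)) (h 0 (suc n))
        (sumAntidiagonal n (λ i l → g (suc i) l)) (sumAntidiagonal n (λ i l → h (suc i) l)))

  sumAntidiagonal-distribˡ-* : ∀ n c g → sumAntidiagonal n (λ i l → c * g i l) ≡ c * sumAntidiagonal n g
  sumAntidiagonal-distribˡ-* zero    c g = refl
  sumAntidiagonal-distribˡ-* (suc n) c g =
    trans (cong (c * g 0 (suc n) +_) (sumAntidiagonal-distribˡ-* n c (λ i l → g (suc i) l)))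
      (sym (*-distribˡ-+ c (g 0 (suc n)) _))

  sumAntidiagonal-weighted : ∀ n (w : ℕ → ℚ) g →
    sumAntidiagonal n (λ i l → w (i ℕ.+ l) * g i l) ≡ w n * sumAntidiagonal n g
  sumAntidiagonal-weighted zero    w g = refl
  sumAntidiagonal-weighted (suc n) w g =
    trans (cong (w (suc n) * g 0 (suc n) +_) (sumAntidiagonal-weighted n (w ∘ suc) (λ i l → g (suc i) l)))
      (sym (*-distribˡ-+ (w (suc n)) (g 0 (suc n)) _))

  sumTo-sumAntidiagonal≤sumTo-sumTo : ∀ J g → (∀ i l → 0ℚ ≤ g i l) →
    sumTo J (λ n → sumAntidiagonal n g) ≤ sumTo J (λ i → sumTo J (g i))
  sumTo-sumAntidiagonal≤sumTo-sumTo zero    g g≥0 = ≤-refl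
  sumTo-sumAntidiagonal≤sumTo-sumTo (suc J) g g≥0 = begin
    sumTo (suc J) (λ n → sumAntidiagonal n g)
      ≡⟨ sumTo-unfoldˡ J _ ⟩
    g 0 0 + sumTo J (λ n → g 0 (suc n) + sumAntidiagonal n g⁺)
      ≡⟨ cong (g 0 0 +_) (sumTo-distrib-+ J _ _) ⟩
    g 0 0 + (sumTo J (λ n → g 0 (suc n)) + sumTo J (λ n → sumAntidiagonal n g⁺))
      ≡⟨ sym (+-assoc (g 0 0) _ _) ⟩
    g 0 0 + sumTo J (λ n → g 0 (suc n)) + sumTo J (λ n → sumAntidiagonal n g⁺)
      ≡⟨ cong (_+ sumTo J (λ n → sumAntidiagonal n g⁺)) (sym (sumTo-unfoldˡ J (g 0))) ⟩
    sumTo (suc J) (g 0) + sumTo J (λ n → sumAntidiagonal n g⁺)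
      ≤⟨ +-monoʳ-≤ (sumTo (suc J) (g 0)) (sumTo-sumAntidiagonal≤sumTo-sumTo J g⁺ (λ i → g≥0 (suc i))) ⟩
    sumTo (suc J) (g 0) + sumTo J (λ i → sumTo J (g⁺ i))
      ≤⟨ +-monoʳ-≤ (sumTo (suc J) (g 0)) (sumTo-mono-≤ J (λ i → sumTo-≤-suc J (g≥0 (suc i)))) ⟩
    sumTo (suc J) (g 0) + sumTo J (λ i → sumTo (suc J) (g⁺ i))
      ≡⟨ sym (sumTo-unfoldˡ J (λ i → sumTo (suc J) (g i))) ⟩
    sumTo (suc J) (λ i → sumTo (suc J) (g i)) ∎
    where
    open ≤-Reasoning
    g⁺ : ℕ → ℕ → ℚ
    g⁺ i = g (suc i)

  cauchyProduct : (ℕ → ℚ) → (ℕ → ℚ) → ℕ → ℚ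
  cauchyProduct f g n = sumAntidiagonal n (λ i l → f i * g l)

  cauchyProduct-recurrence : ∀ x y {f g : ℕ → ℚ} →
    (∀ i → fromℕ (suc i) * f (suc i) ≡ x * f i) → (∀ l → fromℕ (suc l) * g (suc l) ≡ y * g l) →
    ∀ m → fromℕ (suc m) * cauchyProduct f g (suc m) ≡ (x + y) * cauchyProduct f g m
  cauchyProduct-recurrence x y {f} {g} f-rec g-rec m = begin
    fromℕ (suc m) * C (suc m)
      ≡⟨ sym (sumAntidiagonal-weighted (suc m) fromℕ (λ i l → f i * g l)) ⟩
    sumAntidiagonal (suc m) (λ i l → fromℕ (i ℕ.+ l) * (f i * g l))
      ≡⟨ sumAntidiagonal-cong (suc m) leibniz ⟩
    sumAntidiagonal (suc m) (λ i l → fromℕ i * f i * g l + f i * (fromℕ l * g l))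
      ≡⟨ sumAntidiagonal-distrib-+ (suc m) (λ i l → fromℕ i * f i * g l) (λ i l → f i * (fromℕ l * g l)) ⟩
    sumAntidiagonal (suc m) (λ i l → fromℕ i * f i * g l)
      + sumAntidiagonal (suc m) (λ i l → f i * (fromℕ l * g l))
      ≡⟨ cong₂ _+_ shiftˡ shiftʳ ⟩
    x * C m + y * C m
      ≡⟨ sym (*-distribʳ-+ (C m) x y) ⟩
    (x + y) * C m ∎
    where
    open ≡-Reasoning
    C : ℕ → ℚ
    C = cauchyProduct f g

    leibniz : ∀ i l → fromℕ (i ℕ.+ l) * (f i * g l) ≡ fromℕ i * f i * g l + f i * (fromℕ l * g l)
    leibniz i l = trans (cong (_* (f i * g l)) (fromℕ-+ i l))
      (solve 4 (λ a b c d → (a :+ b) :* (c :* d) := a :* c :* d :+ c :* (b :* d)) refl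
        (fromℕ i) (fromℕ l) (f i) (g l))

    shiftˡ : sumAntidiagonal (suc m) (λ i l → fromℕ i * f i * g l) ≡ x * C m
    shiftˡ = begin
      0ℚ * f 0 * g (suc m) + sumAntidiagonal m (λ i l → fromℕ (suc i) * f (suc i) * g l)
        ≡⟨ cong₂ _+_ (solve 2 (λ a b → con 0ℚ :* a :* b := con 0ℚ) refl (f 0) (g (suc m)))
                     (sumAntidiagonal-cong m (λ i l → trans (cong (_* g l) (f-rec i)) (*-assoc x (f i) (g l)))) ⟩
      0ℚ + sumAntidiagonal m (λ i l → x * (f i * g l))
        ≡⟨ trans (+-identityˡ _) (sumAntidiagonal-distribˡ-* m x _) ⟩
      x * C m ∎

    shiftʳ : sumAntidiagonal (suc m) (λ i l → f i * (fromℕ l * g l)) ≡ y * C m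
    shiftʳ = begin
      sumAntidiagonal (suc m) (λ i l → f i * (fromℕ l * g l))
        ≡⟨ sumAntidiagonal-unfoldʳ m (λ i l → f i * (fromℕ l * g l)) ⟩
      sumAntidiagonal m (λ i l → f i * (fromℕ (suc l) * g (suc l))) + f (suc m) * (0ℚ * g 0)
        ≡⟨ cong₂ _+_ (sumAntidiagonal-cong m (λ i l → trans (cong (f i *_) (g-rec l))
                        (solve 3 (λ a b c → a :* (b :* c) := b :* (a :* c)) refl (f i) y (g l))))
                     (solve 2 (λ a b → a :* (con 0ℚ :* b) := con 0ℚ) refl (f (suc m)) (g 0)) ⟩
      sumAntidiagonal m (λ i l → y * (f i * g l)) + 0ℚ
        ≡⟨ trans (+-identityʳ _) (sumAntidiagonal-distribˡ-* m y _) ⟩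
      y * C m ∎

  expTerm-cauchyProduct : ∀ x y n → cauchyProduct (expTerm x) (expTerm y) n ≡ expTerm (x + y) n
  expTerm-cauchyProduct x y zero    = *-identityˡ 1ℚ
  expTerm-cauchyProduct x y (suc m) = begin
    C (suc m)
      ≡⟨ sym (*-identityˡ _) ⟩
    1ℚ * C (suc m)
      ≡⟨ cong (_* C (suc m)) (sym (trans (*-comm 1/[1+ m ] _) (1/[1+]-inverseʳ m))) ⟩
    1/[1+ m ] * fromℕ (suc m) * C (suc m)
      ≡⟨ *-assoc 1/[1+ m ] _ _ ⟩
    1/[1+ m ] * (fromℕ (suc m) * C (suc m))
      ≡⟨ cong (1/[1+ m ] *_) (cauchyProduct-recurrence x y (expTerm-suc x) (expTerm-suc y) m) ⟩
    1/[1+ m ] * ((x + y) * C m)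
      ≡⟨ cong (λ c → 1/[1+ m ] * ((x + y) * c)) (expTerm-cauchyProduct x y m) ⟩
    1/[1+ m ] * ((x + y) * expTerm (x + y) m)
      ≡⟨ *-comm 1/[1+ m ] ((x + y) * expTerm (x + y) m) ⟩
    expTerm (x + y) (suc m) ∎
    where
    open ≡-Reasoning
    C : ℕ → ℚ
    C = cauchyProduct (expTerm x) (expTerm y)

  expPartial : ℕ → ℚ → ℚ
  expPartial J x = sumTo J (expTerm x)

  expPartial-nonNeg : ∀ J {x} → 0ℚ ≤ x → 0ℚ ≤ expPartial J x
  expPartial-nonNeg J x≥0 = sumTo-nonNeg J (expTerm-nonNeg x≥0)

  expPartial-mono-≤ : ∀ J {x y} → 0ℚ ≤ x → x ≤ y → expPartial J x ≤ expPartial J y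
  expPartial-mono-≤ J x≥0 x≤y = sumTo-mono-≤ J (expTerm-mono-≤ x≥0 x≤y)

  expPartial-0 : ∀ J → expPartial J 0ℚ ≡ 1ℚ
  expPartial-0 zero    = refl
  expPartial-0 (suc J) = trans (cong (_+ expTerm 0ℚ (suc J)) (expPartial-0 J))
    (solve 2 (λ a b → con 1ℚ :+ con 0ℚ :* a :* b := con 1ℚ) refl (expTerm 0ℚ J) 1/[1+ J ])

  expPartial-submultiplicative : ∀ J {x y} → 0ℚ ≤ x → 0ℚ ≤ y →
    expPartial J (x + y) ≤ expPartial J x * expPartial J y
  expPartial-submultiplicative J {x} {y} x≥0 y≥0 = begin
    sumTo J (expTerm (x + y))
      ≡⟨ sym (sumTo-cong J (expTerm-cauchyProduct x y)) ⟩
    sumTo J (cauchyProduct (expTerm x) (expTerm y))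
      ≤⟨ sumTo-sumAntidiagonal≤sumTo-sumTo J (λ i l → expTerm x i * expTerm y l)
           (λ i l → nonNeg-* (expTerm-nonNeg x≥0 i) (expTerm-nonNeg y≥0 l)) ⟩
    sumTo J (λ i → sumTo J (λ l → expTerm x i * expTerm y l))
      ≡⟨ sumTo-cong J (λ i → sumTo-distribˡ-* J (expTerm x i) (expTerm y)) ⟩
    sumTo J (λ i → expTerm x i * expPartial J y)
      ≡⟨ sumTo-distribʳ-* J (expTerm x) (expPartial J y) ⟩
    expPartial J x * expPartial J y ∎
    where open ≤-Reasoning

  expPartial*[1-t]≤1 : ∀ J {t} → 0ℚ ≤ t → expPartial J t * (1ℚ - t) ≤ 1ℚ
  expPartial*[1-t]≤1 J {t} t≥0 = ≤-trans dropLastTerm (invariant J)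
    where
    invariant : ∀ J → expPartial J t * (1ℚ - t) + t * expTerm t J ≤ 1ℚ
    invariant zero    = ≤-reflexive (solve 1 (λ a → con 1ℚ :* (con 1ℚ :- a) :+ a :* con 1ℚ := con 1ℚ) refl t)
    invariant (suc J) = begin
      (expPartial J t + expTerm t (suc J)) * (1ℚ - t) + t * expTerm t (suc J)
        ≡⟨ solve 3 (λ P u a → (P :+ u) :* (con 1ℚ :- a) :+ a :* u := P :* (con 1ℚ :- a) :+ u) refl
             (expPartial J t) (expTerm t (suc J)) t ⟩
      expPartial J t * (1ℚ - t) + t * expTerm t J * 1/[1+ J ]
        ≤⟨ +-monoʳ-≤ (expPartial J t * (1ℚ - t))
             (≤-trans (*-monoˡ-≤-≥0 (nonNeg-* t≥0 (expTerm-nonNeg t≥0 J)) (1/[1+]≤1 J))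
                      (≤-reflexive (*-identityʳ (t * expTerm t J)))) ⟩
      expPartial J t * (1ℚ - t) + t * expTerm t J
        ≤⟨ invariant J ⟩
      1ℚ ∎
      where open ≤-Reasoning

    dropLastTerm : expPartial J t * (1ℚ - t) ≤ expPartial J t * (1ℚ - t) + t * expTerm t J
    dropLastTerm = subst (_≤ expPartial J t * (1ℚ - t) + t * expTerm t J) (+-identityʳ _)
      (+-monoʳ-≤ (expPartial J t * (1ℚ - t)) (nonNeg-* t≥0 (expTerm-nonNeg t≥0 J)))

  record ExpAtMost (x : ℚ) (P Q : ℕ) : Set where
    field bound : ∀ J → expPartial J x * fromℕ Q ≤ fromℕ P
  open ExpAtMost

  expAtMost-0 : ∀ {P Q} → Q ℕ.≤ P → ExpAtMost 0ℚ P Q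
  bound (expAtMost-0 {P} {Q} Q≤P) J = begin
    expPartial J 0ℚ * fromℕ Q ≡⟨ cong (_* fromℕ Q) (expPartial-0 J) ⟩
    1ℚ * fromℕ Q              ≡⟨ *-identityˡ (fromℕ Q) ⟩
    fromℕ Q                   ≤⟨ fromℕ-mono-≤ Q≤P ⟩
    fromℕ P                   ∎
    where open ≤-Reasoning

  expAtMost-1/[1+] : ∀ c → ExpAtMost 1/[1+ c ] (suc c) c
  bound (expAtMost-1/[1+] c) J = begin
    expPartial J t * fromℕ c                          ≡⟨ cong (expPartial J t *_) (sym [1-t][1+c]≡c) ⟩
    expPartial J t * ((1ℚ - t) * fromℕ (suc c))       ≡⟨ sym (*-assoc (expPartial J t) _ _) ⟩
    expPartial J t * (1ℚ - t) * fromℕ (suc c)         ≤⟨ *-monoʳ-≤-≥0 (fromℕ-nonNeg (suc c))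
                                                           (expPartial*[1-t]≤1 J (1/[1+]-nonNeg c)) ⟩
    1ℚ * fromℕ (suc c)                                ≡⟨ *-identityˡ (fromℕ (suc c)) ⟩
    fromℕ (suc c)                                     ∎
    where
    open ≤-Reasoning
    t : ℚ
    t = 1/[1+ c ]
    [1-t][1+c]≡c : (1ℚ - t) * fromℕ (suc c) ≡ fromℕ c
    [1-t][1+c]≡c = begin-equality
      (1ℚ - t) * fromℕ (suc c)          ≡⟨ solve 2 (λ a b → (con 1ℚ :- b) :* a := a :- a :* b) refl (fromℕ (suc c)) t ⟩
      fromℕ (suc c) - fromℕ (suc c) * t ≡⟨ cong (fromℕ (suc c) -_) (1/[1+]-inverseʳ c) ⟩
      (1ℚ + fromℕ c) - 1ℚ               ≡⟨ solve 1 (λ a → (con 1ℚ :+ a) :- con 1ℚ := a) refl (fromℕ c) ⟩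
      fromℕ c                           ∎

  expAtMost-+ : ∀ {x y P Q P′ Q′} → 0ℚ ≤ x → 0ℚ ≤ y →
    ExpAtMost x P Q → ExpAtMost y P′ Q′ → ExpAtMost (x + y) (P ℕ.* P′) (Q ℕ.* Q′)
  bound (expAtMost-+ {x} {y} {P} {Q} {P′} {Q′} x≥0 y≥0 ex ey) J = begin
    expPartial J (x + y) * fromℕ (Q ℕ.* Q′)
      ≡⟨ cong (expPartial J (x + y) *_) (fromℕ-* Q Q′) ⟩
    expPartial J (x + y) * (fromℕ Q * fromℕ Q′)
      ≤⟨ *-monoʳ-≤-≥0 (nonNeg-* (fromℕ-nonNeg Q) (fromℕ-nonNeg Q′))
           (expPartial-submultiplicative J x≥0 y≥0) ⟩
    expPartial J x * expPartial J y * (fromℕ Q * fromℕ Q′)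
      ≡⟨ solve 4 (λ a b c d → a :* b :* (c :* d) := a :* c :* (b :* d)) refl
           (expPartial J x) (expPartial J y) (fromℕ Q) (fromℕ Q′) ⟩
    expPartial J x * fromℕ Q * (expPartial J y * fromℕ Q′)
      ≤⟨ *-mono-≤-≥0 (nonNeg-* (expPartial-nonNeg J x≥0) (fromℕ-nonNeg Q))
           (nonNeg-* (expPartial-nonNeg J y≥0) (fromℕ-nonNeg Q′)) (bound ex J) (bound ey J) ⟩
    fromℕ P * fromℕ P′
      ≡⟨ sym (fromℕ-* P P′) ⟩
    fromℕ (P ℕ.* P′) ∎
    where open ≤-Reasoning

  expAtMost-telescope : ∀ {x y P Q R} → 0ℚ ≤ x → 0ℚ ≤ y →
    ExpAtMost x R Q → ExpAtMost y P R → ExpAtMost (x + y) P Q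
  bound (expAtMost-telescope {x} {y} {P} {Q} {R} x≥0 y≥0 ex ey) J = begin
    expPartial J (x + y) * fromℕ Q
      ≤⟨ *-monoʳ-≤-≥0 (fromℕ-nonNeg Q) (expPartial-submultiplicative J x≥0 y≥0) ⟩
    expPartial J x * expPartial J y * fromℕ Q
      ≡⟨ solve 3 (λ a b c → a :* b :* c := b :* (a :* c)) refl (expPartial J x) (expPartial J y) (fromℕ Q) ⟩
    expPartial J y * (expPartial J x * fromℕ Q)
      ≤⟨ *-monoˡ-≤-≥0 (expPartial-nonNeg J y≥0) (bound ex J) ⟩
    expPartial J y * fromℕ R
      ≤⟨ bound ey J ⟩
    fromℕ P ∎
    where open ≤-Reasoning

  expAtMost-*ℕ : ∀ {x P Q} → 0ℚ ≤ x → ExpAtMost x P Q → ∀ n → ExpAtMost (fromℕ n * x) (P ℕ.^ n) (Q ℕ.^ n)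
  bound (expAtMost-*ℕ {x} x≥0 ex zero) J = begin
    expPartial J (0ℚ * x) * 1ℚ ≡⟨ cong (λ z → expPartial J z * 1ℚ) (*-zeroˡ x) ⟩
    expPartial J 0ℚ * 1ℚ       ≤⟨ bound (expAtMost-0 {1} {1} ℕₚ.≤-refl) J ⟩
    1ℚ                         ∎
    where open ≤-Reasoning
  expAtMost-*ℕ {x} {P} {Q} x≥0 ex (suc n) =
    subst (λ z → ExpAtMost z (P ℕ.* P ℕ.^ n) (Q ℕ.* Q ℕ.^ n))
      (solve 2 (λ a b → a :+ b :* a := (con 1ℚ :+ b) :* a) refl x (fromℕ n))
      (expAtMost-+ x≥0 (nonNeg-* (fromℕ-nonNeg n) x≥0) ex (expAtMost-*ℕ x≥0 ex n))

  expAtMost-weaken : ∀ {x P Q P′ Q′} → 0 ℕ.< Q → P ℕ.* Q′ ℕ.≤ P′ ℕ.* Q →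
    ExpAtMost x P Q → ExpAtMost x P′ Q′
  bound (expAtMost-weaken {x} {P} {Q} {P′} {Q′} Q>0 PQ′≤P′Q ex) J =
    *-cancelʳ-≤-pos (fromℕ Q) {{positive (fromℕ-mono-< Q>0)}} (begin
      expPartial J x * fromℕ Q′ * fromℕ Q
        ≡⟨ solve 3 (λ a b c → a :* b :* c := a :* c :* b) refl (expPartial J x) (fromℕ Q′) (fromℕ Q) ⟩
      expPartial J x * fromℕ Q * fromℕ Q′
        ≤⟨ *-monoʳ-≤-≥0 (fromℕ-nonNeg Q′) (bound ex J) ⟩
      fromℕ P * fromℕ Q′
        ≡⟨ sym (fromℕ-* P Q′) ⟩
      fromℕ (P ℕ.* Q′)
        ≤⟨ fromℕ-mono-≤ PQ′≤P′Q ⟩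
      fromℕ (P′ ℕ.* Q)
        ≡⟨ fromℕ-* P′ Q ⟩
      fromℕ P′ * fromℕ Q ∎)
    where open ≤-Reasoning

  expAtMost-antimono : ∀ {x y P Q} → 0ℚ ≤ x → x ≤ y → ExpAtMost y P Q → ExpAtMost x P Q
  bound (expAtMost-antimono {Q = Q} x≥0 x≤y ey) J =
    ≤-trans (*-monoʳ-≤-≥0 (fromℕ-nonNeg Q) (expPartial-mono-≤ J x≥0 x≤y)) (bound ey J)

  expAtMost-fromℕ : ∀ c z → ExpAtMost (fromℕ z) (suc c ℕ.^ (suc c ℕ.* z)) (c ℕ.^ (suc c ℕ.* z))
  expAtMost-fromℕ c z =
    subst (λ w → ExpAtMost w (suc c ℕ.^ (suc c ℕ.* z)) (c ℕ.^ (suc c ℕ.* z))) [1+c]z/[1+c]≡z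
      (expAtMost-*ℕ (1/[1+]-nonNeg c) (expAtMost-1/[1+] c) (suc c ℕ.* z))
    where
    [1+c]z/[1+c]≡z : fromℕ (suc c ℕ.* z) * 1/[1+ c ] ≡ fromℕ z
    [1+c]z/[1+c]≡z = begin
      fromℕ (suc c ℕ.* z) * 1/[1+ c ]       ≡⟨ cong (_* 1/[1+ c ]) (fromℕ-* (suc c) z) ⟩
      fromℕ (suc c) * fromℕ z * 1/[1+ c ]   ≡⟨ solve 3 (λ a b d → a :* b :* d := b :* (a :* d)) refl
                                                   (fromℕ (suc c)) (fromℕ z) 1/[1+ c ] ⟩
      fromℕ z * (fromℕ (suc c) * 1/[1+ c ]) ≡⟨ cong (fromℕ z *_) (1/[1+]-inverseʳ c) ⟩
      fromℕ z * 1ℚ                          ≡⟨ *-identityʳ (fromℕ z) ⟩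
      fromℕ z                               ∎
      where open ≡-Reasoning

  fact*expTerm : ∀ m J → fromℕ (fact J) * expTerm (fromℕ m) J ≡ fromℕ (m ℕ.^ J)
  fact*expTerm m zero    = *-identityʳ (fromℕ 1)
  fact*expTerm m (suc J) = begin
    fromℕ (suc J ℕ.* fact J) * (fromℕ m * u * 1/[1+ J ])
      ≡⟨ cong (_* (fromℕ m * u * 1/[1+ J ])) (fromℕ-* (suc J) (fact J)) ⟩
    fromℕ (suc J) * fromℕ (fact J) * (fromℕ m * u * 1/[1+ J ])
      ≡⟨ solve 5 (λ a b c d e → a :* b :* (c :* d :* e) := c :* (b :* d) :* (a :* e)) refl
           (fromℕ (suc J)) (fromℕ (fact J)) (fromℕ m) u 1/[1+ J ] ⟩
    fromℕ m * (fromℕ (fact J) * u) * (fromℕ (suc J) * 1/[1+ J ])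
      ≡⟨ cong₂ (λ a b → fromℕ m * a * b) (fact*expTerm m J) (1/[1+]-inverseʳ J) ⟩
    fromℕ m * fromℕ (m ℕ.^ J) * 1ℚ
      ≡⟨ trans (*-identityʳ _) (sym (fromℕ-* m (m ℕ.^ J))) ⟩
    fromℕ (m ℕ.^ suc J) ∎
    where
    open ≡-Reasoning
    u : ℚ
    u = expTerm (fromℕ m) J

  fromℕ-expScaled : ∀ m J → fromℕ (expScaled m J) ≡ fromℕ (fact J) * expPartial J (fromℕ m)
  fromℕ-expScaled m zero    = sym (*-identityʳ (fromℕ 1))
  fromℕ-expScaled m (suc J) = begin
    fromℕ (suc J ℕ.* expScaled m J ℕ.+ m ℕ.^ suc J)
      ≡⟨ trans (fromℕ-+ (suc J ℕ.* expScaled m J) (m ℕ.^ suc J))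
               (cong (_+ fromℕ (m ℕ.^ suc J)) (fromℕ-* (suc J) (expScaled m J))) ⟩
    fromℕ (suc J) * fromℕ (expScaled m J) + fromℕ (m ℕ.^ suc J)
      ≡⟨ cong₂ (λ a b → fromℕ (suc J) * a + b) (fromℕ-expScaled m J) (sym (fact*expTerm m (suc J))) ⟩
    fromℕ (suc J) * (fromℕ (fact J) * P) + fromℕ (suc J ℕ.* fact J) * u
      ≡⟨ cong (λ a → fromℕ (suc J) * (fromℕ (fact J) * P) + a * u) (fromℕ-* (suc J) (fact J)) ⟩
    fromℕ (suc J) * (fromℕ (fact J) * P) + fromℕ (suc J) * fromℕ (fact J) * u
      ≡⟨ solve 4 (λ a b c d → a :* (b :* c) :+ a :* b :* d := a :* b :* (c :+ d)) refl
           (fromℕ (suc J)) (fromℕ (fact J)) P u ⟩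
    fromℕ (suc J) * fromℕ (fact J) * (P + u)
      ≡⟨ cong (_* (P + u)) (sym (fromℕ-* (suc J) (fact J))) ⟩
    fromℕ (fact (suc J)) * expPartial (suc J) (fromℕ m) ∎
    where
    open ≡-Reasoning
    P u : ℚ
    P = expPartial J (fromℕ m)
    u = expTerm (fromℕ m) (suc J)

  expAtMost⇒ExpLe : ∀ {m K} → ExpAtMost (fromℕ m) K 1 → ExpLe m K
  expAtMost⇒ExpLe {m} {K} e J = fromℕ-cancel-≤ (begin
    fromℕ (expScaled m J)                  ≡⟨ fromℕ-expScaled m J ⟩
    fromℕ (fact J) * expPartial J (fromℕ m) ≤⟨ *-monoˡ-≤-≥0 (fromℕ-nonNeg (fact J)) eJ ⟩
    fromℕ (fact J) * fromℕ K                ≡⟨ trans (*-comm (fromℕ (fact J)) (fromℕ K)) (sym (fromℕ-* K (fact J))) ⟩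
    fromℕ (K ℕ.* fact J)                    ∎)
    where
    open ≤-Reasoning
    eJ : expPartial J (fromℕ m) ≤ fromℕ K
    eJ = subst (_≤ fromℕ K) (trans (cong (expPartial J (fromℕ m) *_) (+-identityʳ 1ℚ)) (*-identityʳ _))
           (bound e J)

open ExpBounds
  using (ExpAtMost; fromℕ; fromℕ-+; fromℕ-nonNeg; fromℕ-mono-≤; expAtMost-0; expAtMost-telescope;
         expAtMost-weaken; expAtMost-antimono; expAtMost-fromℕ; expAtMost⇒ExpLe)
open import Data.Nat using (zero; suc; _+_; _*_; _^_; _∸_; _≤_; _<_; _≤?_; _≤ᵇ_; _<ᵇ_; z≤n)
open import Data.Nat.Properties
open import Data.Nat.ListAction using (sum)
open import Data.Nat.Solver using (module +-*-Solver)
open import Data.Bool using (Bool; true; false; _∧_; not; if_then_else_)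
open import Data.Bool.Properties using (∧-zeroʳ; ∧-identityʳ; T-≡)
open import Data.Fin using (Fin; zero; suc; toℕ)
open import Data.List using (List; []; _∷_; length; filterᵇ; tabulate; allFin; cartesianProduct; map; _++_)
open import Data.List.Properties using (filter-++; length-++; map-tabulate)
open import Data.Product using (_×_; _,_)
open import Data.Unit using (⊤)
open import Algebra.Properties.CommutativeMonoid.Sum +-0-commutativeMonoid using (sum-syntax; sum-cong-≗)
open import Function.Bundles using (Equivalence)
open import Relation.Nullary using (yes; no; contradiction)
open import Relation.Nullary.Decidable using (T?)

pow-ratio-mono : ∀ {A B a k} → A ≤ B → a ≤ k → B ^ a * A ^ k ≤ B ^ k * A ^ a
pow-ratio-mono {A} {B} {a} {k} A≤B a≤k = begin
  B ^ a * A ^ k            ≡⟨ cong (λ e → B ^ a * A ^ e) (sym a+r≡k) ⟩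
  B ^ a * A ^ (a + r)      ≡⟨ cong (B ^ a *_) (^-distribˡ-+-* A a r) ⟩
  B ^ a * (A ^ a * A ^ r)  ≤⟨ *-monoʳ-≤ (B ^ a) (*-monoʳ-≤ (A ^ a) (^-monoˡ-≤ r A≤B)) ⟩
  B ^ a * (A ^ a * B ^ r)  ≡⟨ solve 3 (λ p q s → p :* (q :* s) := p :* s :* q) refl (B ^ a) (A ^ a) (B ^ r) ⟩
  B ^ a * B ^ r * A ^ a    ≡⟨ cong (_* A ^ a) (sym (^-distribˡ-+-* B a r)) ⟩
  B ^ (a + r) * A ^ a      ≡⟨ cong (λ e → B ^ e * A ^ a) a+r≡k ⟩
  B ^ k * A ^ a            ∎
  where
  open ≤-Reasoning
  open +-*-Solver
  r : ℕ
  r = k ∸ a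
  a+r≡k : a + r ≡ k
  a+r≡k = m+[n∸m]≡n a≤k

expAtMost-harmonicTerm : ∀ c z {k} → suc (suc c) * z ≤ k → ExpAtMost (fromℕ z) (suc (suc c) ^ k) (suc c ^ k)
expAtMost-harmonicTerm c z [2+c]z≤k =
  expAtMost-weaken (m^n>0 (suc c) (suc (suc c) * z)) (pow-ratio-mono (n≤1+n (suc c)) [2+c]z≤k)
    (expAtMost-fromℕ (suc c) z)

HarmonicallyBounded : ℕ → ℕ → List ℕ → Set
HarmonicallyBounded k i []       = ⊤
HarmonicallyBounded k i (z ∷ zs) = i * z ≤ k × HarmonicallyBounded k (suc i) zs

harmonicallyBounded-sum≡0 : ∀ {k i} zs → k < i → HarmonicallyBounded k i zs → sum zs ≡ 0
harmonicallyBounded-sum≡0 []           k<i _          = refl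
harmonicallyBounded-sum≡0 (zero ∷ zs)  k<i (_ , hzs)  = harmonicallyBounded-sum≡0 zs (m≤n⇒m≤1+n k<i) hzs
harmonicallyBounded-sum≡0 {i = i} (suc z ∷ zs) k<i (iz≤k , _) =
  contradiction (≤-trans (m≤m*n i (suc z)) iz≤k) (<⇒≱ k<i)

expAtMost-harmonicTail : ∀ {k} c zs → suc c ≤ k → HarmonicallyBounded k (suc (suc c)) zs →
  ExpAtMost (fromℕ (sum zs)) (k ^ k) (suc c ^ k)
expAtMost-harmonicTail {k} c [] c<k _ = expAtMost-0 (^-monoˡ-≤ k c<k)
expAtMost-harmonicTail {k} c (z ∷ zs) c<k (hz , hzs) with suc (suc c) ≤? k
... | yes 1+c<k =
  subst (λ x → ExpAtMost x (k ^ k) (suc c ^ k)) (sym (fromℕ-+ z (sum zs)))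
    (expAtMost-telescope (fromℕ-nonNeg z) (fromℕ-nonNeg (sum zs))
      (expAtMost-harmonicTerm c z hz) (expAtMost-harmonicTail (suc c) zs 1+c<k hzs))
... | no 1+c≮k =
  subst (λ s → ExpAtMost (fromℕ s) (k ^ k) (suc c ^ k))
    (sym (harmonicallyBounded-sum≡0 (z ∷ zs) (≰⇒> 1+c≮k) (hz , hzs)))
    (expAtMost-0 (^-monoˡ-≤ k c<k))

expAtMost-harmonic : ∀ {k} zs → 1 ≤ k → HarmonicallyBounded k 1 zs →
  ExpAtMost (fromℕ (sum zs ∸ k)) (k ^ k) 1
expAtMost-harmonic {suc k} []       _   _            = expAtMost-0 (m^n>0 (suc k) (suc k))
expAtMost-harmonic {k}     (z ∷ zs) 1≤k (1*z≤k , hzs) =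
  expAtMost-antimono (fromℕ-nonNeg (z + sum zs ∸ k)) (fromℕ-mono-≤ sum∸k≤tail)
    (subst (ExpAtMost (fromℕ (sum zs)) (k ^ k)) (^-zeroˡ k) (expAtMost-harmonicTail 0 zs 1≤k hzs))
  where
  sum∸k≤tail : z + sum zs ∸ k ≤ sum zs
  sum∸k≤tail = begin
    z + sum zs ∸ k  ≤⟨ ∸-monoˡ-≤ k (+-monoˡ-≤ (sum zs) (subst (_≤ k) (*-identityˡ z) 1*z≤k)) ⟩
    k + sum zs ∸ k  ≡⟨ m+n∸m≡n k (sum zs) ⟩
    sum zs          ∎
    where open ≤-Reasoning

harmonicallyBounded⇒LeKLogK : ∀ {k} zs → 1 ≤ k → HarmonicallyBounded k 1 zs → LeKLogK (sum zs) k
harmonicallyBounded⇒LeKLogK zs 1≤k hzs = expAtMost⇒ExpLe (expAtMost-harmonic zs 1≤k hzs)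

fromBool : Bool → ℕ
fromBool b = if b then 1 else 0

count : ∀ {n} → (Fin n → Bool) → ℕ
count {n} P = ∑[ a < n ] fromBool (P a)

count-false : ∀ {n} (P : Fin n → Bool) → (∀ a → P a ≡ false) → count P ≡ 0
count-false {zero}  P P≡false = refl
count-false {suc n} P P≡false rewrite P≡false zero = count-false (P ∘ suc) (P≡false ∘ suc)

∑-mono-≤ : ∀ {n} {f g : Fin n → ℕ} → (∀ a → f a ≤ g a) → ∑[ a < n ] f a ≤ ∑[ a < n ] g a
∑-mono-≤ {zero}  f≤g = z≤n
∑-mono-≤ {suc n} f≤g = +-mono-≤ (f≤g zero) (∑-mono-≤ (f≤g ∘ suc))

∑-if : ∀ {n} (P : Fin n → Bool) r → ∑[ a < n ] (if P a then r else 0) ≡ count P * r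
∑-if {zero}  P r = refl
∑-if {suc n} P r with P zero
... | true  = cong (r +_) (∑-if (P ∘ suc) r)
... | false = ∑-if (P ∘ suc) r

length-filterᵇ-tabulate : ∀ {A : Set} {n} (p : A → Bool) (f : Fin n → A) →
  length (filterᵇ p (tabulate f)) ≡ count (p ∘ f)
length-filterᵇ-tabulate {n = zero}  p f = refl
length-filterᵇ-tabulate {n = suc n} p f with p (f zero)
... | true  = cong suc (length-filterᵇ-tabulate p (f ∘ suc))
... | false = length-filterᵇ-tabulate p (f ∘ suc)

length-filterᵇ-cartesianProduct : ∀ {A : Set} {m n} (p : A × Fin n → Bool) (f : Fin m → A) →
  length (filterᵇ p (cartesianProduct (tabulate f) (allFin n))) ≡ ∑[ a < m ] count (λ b → p (f a , b))
length-filterᵇ-cartesianProduct {m = zero}      p f = refl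
length-filterᵇ-cartesianProduct {m = suc m} {n} p f = begin
  length (filterᵇ p (row ++ rest))
    ≡⟨ cong length (filter-++ (T? ∘ p) row rest) ⟩
  length (filterᵇ p row ++ filterᵇ p rest)
    ≡⟨ length-++ (filterᵇ p row) ⟩
  length (filterᵇ p row) + length (filterᵇ p rest)
    ≡⟨ cong₂ _+_ (trans (cong (length ∘ filterᵇ p) (map-tabulate id (f zero ,_)))
                        (length-filterᵇ-tabulate p (f zero ,_)))
                 (length-filterᵇ-cartesianProduct p (f ∘ suc)) ⟩
  ∑[ a < suc m ] count (λ b → p (f a , b)) ∎
  where
  open ≡-Reasoning
  row  = map (f zero ,_) (allFin n)
  rest = cartesianProduct (tabulate (f ∘ suc)) (allFin n)

countUpTo : ∀ {n} → (Fin n → Bool) → ℕ → ℕ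
countUpTo w t = count (λ a → w a ∧ (toℕ a ≤ᵇ t))

countAbove : ∀ {n} → (Fin n → Bool) → ℕ → ℕ
countAbove w t = count (λ b → (t <ᵇ toℕ b) ∧ w b)

module _ {n : ℕ} (inY : Fin n → Bool) where

  inX : Fin n → Bool
  inX = not ∘ inY

  count-isBad : ∀ a → count (λ b → isBad inY (a , b)) ≡ (if inY a then countAbove inX (toℕ a) else 0)
  count-isBad a with inY a
  ... | true  = refl
  ... | false = count-false {n} (λ b → (toℕ a <ᵇ toℕ b) ∧ false) (λ b → ∧-zeroʳ (toℕ a <ᵇ toℕ b))

  badCount≡∑ : badCount n inY ≡ ∑[ a < n ] (if inY a then countAbove inX (toℕ a) else 0)
  badCount≡∑ = trans (length-filterᵇ-cartesianProduct (isBad inY) id) (sum-cong-≗ count-isBad)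

  count-crossing≥ : ∀ t a → (if inY a ∧ (toℕ a ≤ᵇ t) then countAbove inX t else 0) ≤
    count (λ b → isBad inY (a , b) ∧ ((toℕ a ≤ᵇ t) ∧ (t <ᵇ toℕ b)))
  count-crossing≥ t a with inY a | toℕ a ≤ᵇ t in a≤ᵇt
  ... | true  | true  = ≤-reflexive (sum-cong-≗ (λ b → cong fromBool (sym (a<b-redundant b))))
    where
    a<b-redundant : ∀ b → ((toℕ a <ᵇ toℕ b) ∧ inX b) ∧ (t <ᵇ toℕ b) ≡ (t <ᵇ toℕ b) ∧ inX b
    a<b-redundant b with t <ᵇ toℕ b in t<ᵇb
    ... | false = ∧-zeroʳ _
    ... | true  rewrite Equivalence.to T-≡ (<⇒<ᵇ (≤-<-trans (≤ᵇ⇒≤ (toℕ a) t (Equivalence.from T-≡ a≤ᵇt))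
                                                             (<ᵇ⇒< t (toℕ b) (Equivalence.from T-≡ t<ᵇb))))
                = ∧-identityʳ (inX b)
  ... | true  | false = z≤n
  ... | false | _     = z≤n

  countUpTo*countAbove≤crossCount : ∀ t → countUpTo inY t * countAbove inX t ≤ crossCount n inY t
  countUpTo*countAbove≤crossCount t = begin
    countUpTo inY t * countAbove inX t
      ≡⟨ sym (∑-if (λ a → inY a ∧ (toℕ a ≤ᵇ t)) (countAbove inX t)) ⟩
    ∑[ a < n ] (if inY a ∧ (toℕ a ≤ᵇ t) then countAbove inX t else 0)
      ≤⟨ ∑-mono-≤ (count-crossing≥ t) ⟩
    ∑[ a < n ] count (λ b → isBad inY (a , b) ∧ ((toℕ a ≤ᵇ t) ∧ (t <ᵇ toℕ b)))
      ≡⟨ sym (length-filterᵇ-cartesianProduct crossing id) ⟩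
    crossCount n inY t ∎
    where
    open ≤-Reasoning
    crossing : Fin n × Fin n → Bool
    crossing (a , b) = isBad inY (a , b) ∧ ((toℕ a ≤ᵇ t) ∧ (t <ᵇ toℕ b))

suc≤ᵇsuc : ∀ x y → (suc x ≤ᵇ suc y) ≡ (x ≤ᵇ y)
suc≤ᵇsuc zero    y = refl
suc≤ᵇsuc (suc x) y = refl

countUpTo-zero : ∀ {m} (w : Fin (suc m) → Bool) → countUpTo w 0 ≡ fromBool (w zero)
countUpTo-zero w = begin
  fromBool (w zero ∧ true) + count (λ a → w (suc a) ∧ (suc (toℕ a) ≤ᵇ 0))
    ≡⟨ cong₂ _+_ (cong fromBool (∧-identityʳ (w zero)))
                 (count-false (λ a → w (suc a) ∧ false) (λ a → ∧-zeroʳ (w (suc a)))) ⟩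
  fromBool (w zero) + 0
    ≡⟨ +-identityʳ _ ⟩
  fromBool (w zero) ∎
  where open ≡-Reasoning

countUpTo-suc : ∀ {m} (w : Fin (suc m) → Bool) (a : Fin m) →
  countUpTo w (suc (toℕ a)) ≡ fromBool (w zero) + countUpTo (w ∘ suc) (toℕ a)
countUpTo-suc w a = cong₂ _+_ (cong fromBool (∧-identityʳ (w zero)))
  (sum-cong-≗ (λ a′ → cong (λ b → fromBool (w (suc a′) ∧ b)) (suc≤ᵇsuc (toℕ a′) (toℕ a))))

selectedValues : ∀ {m} → (Fin m → Bool) → (Fin m → ℕ) → List ℕ
selectedValues {zero}  w F = []
selectedValues {suc m} w F = if w zero then F zero ∷ rest else rest
  where
  rest : List ℕ
  rest = selectedValues (w ∘ suc) (F ∘ suc)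

sum-selectedValues : ∀ {m} (w : Fin m → Bool) F →
  sum (selectedValues w F) ≡ ∑[ a < m ] (if w a then F a else 0)
sum-selectedValues {zero}  w F = refl
sum-selectedValues {suc m} w F with w zero
... | true  = cong (F zero +_) (sum-selectedValues (w ∘ suc) (F ∘ suc))
... | false = sum-selectedValues (w ∘ suc) (F ∘ suc)

-- countUpTo w (toℕ a) is the rank of a among the indices selected by w.
selectedValues-harmonic : ∀ {k m} c (w : Fin m → Bool) (F : Fin m → ℕ) →
  (∀ a → w a ≡ true → (c + countUpTo w (toℕ a)) * F a ≤ k) →
  HarmonicallyBounded k (suc c) (selectedValues w F)
selectedValues-harmonic {m = zero}      c w F h = _
selectedValues-harmonic {k} {suc m} c w F h = byHead (w zero) refl
  where
  rest : List ℕ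
  rest = selectedValues (w ∘ suc) (F ∘ suc)

  restHarmonic : ∀ b → w zero ≡ b → HarmonicallyBounded k (suc (fromBool b + c)) rest
  restHarmonic b w₀≡b = selectedValues-harmonic (fromBool b + c) (w ∘ suc) (F ∘ suc) λ a wa →
    subst (λ x → x * F (suc a) ≤ k) (shift a w₀≡b) (h (suc a) wa)
    where
    shift : ∀ a → w zero ≡ b → c + countUpTo w (toℕ (suc a)) ≡ fromBool b + c + countUpTo (w ∘ suc) (toℕ a)
    shift a refl = begin
      c + countUpTo w (suc (toℕ a))                         ≡⟨ cong (c +_) (countUpTo-suc w a) ⟩
      c + (fromBool (w zero) + countUpTo (w ∘ suc) (toℕ a)) ≡⟨ sym (+-assoc c _ _) ⟩
      c + fromBool (w zero) + countUpTo (w ∘ suc) (toℕ a)   ≡⟨ cong (_+ countUpTo (w ∘ suc) (toℕ a)) (+-comm c _) ⟩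
      fromBool (w zero) + c + countUpTo (w ∘ suc) (toℕ a)   ∎
      where open ≡-Reasoning

  byHead : ∀ b → w zero ≡ b → HarmonicallyBounded k (suc c) (if b then F zero ∷ rest else rest)
  byHead true  w₀ = headBound , restHarmonic true w₀
    where
    headBound : suc c * F zero ≤ k
    headBound = subst (λ x → x * F zero ≤ k)
      (trans (cong (c +_) (trans (countUpTo-zero w) (cong fromBool w₀))) (+-comm c 1))
      (h zero w₀)
  byHead false w₀ = restHarmonic false w₀

lemma3p7 : (n k : ℕ) → 1 ≤ n → 1 ≤ k → (inY : Fin n → Bool)
    → (∀ (t : ℕ) → crossCount n inY t ≤ k)
    → LeKLogK (badCount n inY) k
lemma3p7 n k _ 1≤k inY cross≤k =
  subst (λ N → LeKLogK N k) (sym badCount≡sum) (harmonicallyBounded⇒LeKLogK zs 1≤k harmonic)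
  where
  xAbove : Fin n → ℕ
  xAbove a = countAbove (inX inY) (toℕ a)
  zs : List ℕ
  zs = selectedValues inY xAbove
  badCount≡sum : badCount n inY ≡ sum zs
  badCount≡sum = trans (badCount≡∑ inY) (sym (sum-selectedValues inY xAbove))
  harmonic : HarmonicallyBounded k 1 zs
  harmonic = selectedValues-harmonic 0 inY xAbove
    (λ a _ → ≤-trans (countUpTo*countAbove≤crossCount inY (toℕ a)) (cross≤k (toℕ a)))
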